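{- Let $m\ge1$, $q=2^m$, $k=\mathbb F_q$, $k_2=\mathbb F_{q^2}$, $a\in k^*$, $b,c\in k$, and with notation as in the context let $U=\{u\in k_2:\langle u,\lambda\rangle_R=0\ \forall\lambda\in k\}$. Then $U=\operatorname{Tr}_{k_2/k}^{ -1}(W)$. Moreover, for any $u\in U$, with $z=\operatorname{Tr}_{k_2/k}(u)\in W$, one has $\tilde Q(u)=Q(z)$ if and only if $P(z)=0$ or $z=0$.
   Context: $P(x)=a^2x^5+b^2x+a$, $E_{ab}(x)=a^4x^{16}+b^4x^8+b^2x^2+ax$, $W$ = set of roots of $E_{ab}$ in $k$. $R(x)=ax^4+bx^2+c^2x$ and $\langle x,y\rangle_R=\operatorname{Tr}_{k_2/\mathbb F_2}(xR(y)+yR(x))$ for $x,y\in k_2$. $Q(x)=\operatorname{Tr}_{k/\mathbb F_2}(ax^5+bx^3+cx)$ for $x\in k$ and $\tilde Q(x)=\operatorname{Tr}_{k_2/\mathbb F_2}(ax^5+bx^3+cx)$ for $x\in k_2$. -}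

module Defs where

open import Level using (Level; _⊔_) renaming (suc to lsuc)
open import Data.Nat using (ℕ; zero; suc) renaming (_^_ to _^ℕ_; _*_ to _*ℕ_)
open import Data.Fin using (Fin)
open import Data.Product using (Σ; _×_)
open import Relation.Nullary using (¬_)
open import Relation.Binary.PropositionalEquality using (_≡_)
open import Algebra.Bundles using (CommutativeRing)

record FieldOfOrder (n : ℕ) (ℓ₁ ℓ₂ : Level) : Set (lsuc (ℓ₁ ⊔ ℓ₂)) where
  field
    cring     : CommutativeRing ℓ₁ ℓ₂
  open CommutativeRing cring public
  field
    0≉1       : ¬ (0# ≈ 1#)
    inverse   : ∀ x → ¬ (x ≈ 0#) → Σ Carrier (λ y → x * y ≈ 1#)
    enum      : Fin n → Carrier
    enum-inj  : ∀ i j → enum i ≈ enum j → i ≡ j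
    enum-surj : ∀ x → Σ (Fin n) (λ i → enum i ≈ x)

-- The setting of the paper: m, q = 2^m, and a field K2 = k₂ of order q² = 2^(2m)
-- (which automatically has characteristic 2).
module Setting {ℓ₁ ℓ₂ : Level} (m : ℕ) (K2 : FieldOfOrder (2 ^ℕ (2 *ℕ m)) ℓ₁ ℓ₂) where
  open FieldOfOrder K2

  q : ℕ
  q = 2 ^ℕ m

  pow : Carrier → ℕ → Carrier
  pow x zero    = 1#
  pow x (suc n) = x * pow x n

  sumTo : ℕ → (ℕ → Carrier) → Carrier
  sumTo zero    f = 0#
  sumTo (suc n) f = sumTo n f + f n

  -- k = F_q ⊆ k₂ is the subfield of elements fixed by x ↦ x^q
  inK : Carrier → Set ℓ₂
  inK x = pow x q ≈ x

  Tr-k2 : Carrier → Carrier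
  Tr-k2 x = sumTo (2 *ℕ m) (λ i → pow x (2 ^ℕ i))

  Tr-k : Carrier → Carrier       -- Tr_{k/F₂}(x) = Σ_{i<m} x^(2^i), used for x ∈ k
  Tr-k x = sumTo m (λ i → pow x (2 ^ℕ i))

  Tr-rel : Carrier → Carrier
  Tr-rel x = x + pow x q

  module Params (a b c : Carrier) where
    P : Carrier → Carrier
    P x = pow a 2 * pow x 5 + pow b 2 * x + a

    E : Carrier → Carrier
    E x = pow a 4 * pow x 16 + pow b 4 * pow x 8 + pow b 2 * pow x 2 + a * x

    inW : Carrier → Set ℓ₂
    inW z = inK z × (E z ≈ 0#)

    R : Carrier → Carrier
    R x = a * pow x 4 + b * pow x 2 + pow c 2 * x

    ⟨_,_⟩R : Carrier → Carrier → Carrier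
    ⟨ x , y ⟩R = Tr-k2 (x * R y + y * R x)

    inU : Carrier → Set (ℓ₁ ⊔ ℓ₂)
    inU u = ∀ l → inK l → ⟨ u , l ⟩R ≈ 0#

    Q : Carrier → Carrier
    Q x = Tr-k (a * pow x 5 + b * pow x 3 + c * x)

    Q~ : Carrier → Carrier
    Q~ x = Tr-k2 (a * pow x 5 + b * pow x 3 + c * x)

-- Write z = Tr_{k₂/k}(u) = u + u^q and N = u^{q+1}.  For λ ∈ k, the tower Tr_{k₂/F₂} = Tr_{k/F₂} ∘ Tr_{k₂/k},
-- additivity of R and the invariance Tr_{k/F₂}(y²) = Tr_{k/F₂}(y) turn ⟨u,λ⟩_R into Tr_{k/F₂}(λ⁴ E_{ab}(z));
-- since λ ↦ λ⁴ is onto k and the trace form of k is nondegenerate, u ∈ U iff E_{ab}(z) = 0.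
-- Expanding ax⁵ + bx³ + cx at x = u + u^q gives Q(z) = Q̃(u) + Tr_{k/F₂}(N² z P(z)).  When E_{ab}(z) = 0,
-- M = z⁵P(z) satisfies M² + M = z⁴E_{ab}(z) = 0, so M ∈ F₂, and for z ≠ 0 the element N/z² = w² + w
-- (w = u/z) has trace (u^q + u)/z = 1; hence the cross term equals M, which vanishes iff P(z) = 0 or z = 0.
-- The finite-field facts behind this are obtained from the enumeration of k₂: x^{q²} = x by comparing
-- products over k₂ before and after scaling, and Tr_{k₂/F₂} ≢ 0 because it is a polynomial of degree
-- 2^{2m-1} < q².

module Submission where

open import Defs
open import Level using (Level)
open import Data.Nat as ℕ using (ℕ; zero; suc; _≤_; s≤s; _∸_) renaming (_^_ to _^ℕ_; _*_ to _*ℕ_; _+_ to _+ℕ_)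
import Data.Nat.Properties as ℕ
open import Data.Fin as Fin using (Fin)
import Data.Fin.Properties as Fin
open import Data.Fin.Properties using (¬∀⟶∃¬)
open import Data.Vec.Functional using (removeAt)
open import Data.Fin.Permutation using (Permutation; permutation)
open import Data.Product using (_×_; _,_; proj₁; proj₂; ∃)
open import Data.Sum using (_⊎_; inj₁; inj₂; swap; map₁)
open import Data.Bool using (Bool; true; false; _xor_; _∧_)
open import Data.Empty using (⊥-elim)
open import Data.List using (List; []; _∷_; length)
open import Data.List.Relation.Unary.All using (All; []; _∷_)
open import Data.Maybe using (Maybe; just; nothing)
open import Relation.Nullary using (¬_; Dec; yes; no)
open import Relation.Binary.PropositionalEquality as ≡ using (_≡_)
open import Function using (_∘_)
open import Function.Construct.Composition using (_⇔-∘_)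
open import Function.Bundles using (_⇔_; mk⇔; Equivalence)
open import Algebra.Bundles using (CommutativeRing; RawRing)
open import Algebra.Definitions using (AlmostLeftCancellative; AlmostRightCancellative)
open import Algebra.Consequences.Setoid using (comm∧almostCancelˡ⇒almostCancelʳ)
import Algebra.Properties.CommutativeMonoid.Sum as Sum
import Algebra.Properties.Semiring.Exp as Exp
import Algebra.Properties.CommutativeSemiring.Exp as CommutativeSemiringExp
import Algebra.Properties.Semiring.Mult as Mult
import Algebra.Properties.AbelianGroup as AbelianGroupProperties
import Algebra.Properties.Ring as RingProperties
import Algebra.Solver.Ring
import Algebra.Solver.Ring.NaturalCoefficients.Default as NaturalSolver
open import Algebra.Solver.Ring.AlmostCommutativeRing using (fromCommutativeRing; _-Raw-AlmostCommutative⟶_)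

module FiniteField {n ℓ₁ ℓ₂} (F : FieldOfOrder n ℓ₁ ℓ₂) where
  open FieldOfOrder F
  open Exp semiring using (_^_; ^-congˡ)
  open Mult semiring using () renaming (_×_ to _·_)
  module ∑ = Sum +-commutativeMonoid
  module ∏ = Sum *-commutativeMonoid
  open ∑ using () renaming (sum to ∑)
  open ∏ using () renaming (sum to ∏)
  open import Relation.Binary.Reasoning.Setoid setoid

  index : Carrier → Fin n
  index x = proj₁ (enum-surj x)

  enum-index : ∀ x → enum (index x) ≈ x
  enum-index x = proj₂ (enum-surj x)

  infix 4 _≟_
  _≟_ : (x y : Carrier) → Dec (x ≈ y)
  x ≟ y with index x Fin.≟ index y
  ... | yes p = yes (trans (sym (enum-index x)) (trans (reflexive (≡.cong enum p)) (enum-index y)))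
  ... | no ¬p = no λ x≈y → ¬p (enum-inj _ _ (trans (enum-index x) (trans x≈y (sym (enum-index y)))))

  _⁻¹ : ∀ x → ¬ x ≈ 0# → Carrier
  (x ⁻¹) x≉0 = proj₁ (inverse x x≉0)

  *-inverseʳ : ∀ x (x≉0 : ¬ x ≈ 0#) → x * (x ⁻¹) x≉0 ≈ 1#
  *-inverseʳ x x≉0 = proj₂ (inverse x x≉0)

  *-inverseˡ : ∀ x (x≉0 : ¬ x ≈ 0#) → (x ⁻¹) x≉0 * x ≈ 1#
  *-inverseˡ x x≉0 = trans (*-comm _ x) (*-inverseʳ x x≉0)

  *-cancelˡ-nonZero : AlmostLeftCancellative _≈_ 0# _*_
  *-cancelˡ-nonZero x y z x≉0 xy≈xz = begin
    y                  ≈⟨ cancel y ⟩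
    x⁻¹ * (x * y)      ≈⟨ *-congˡ xy≈xz ⟩
    x⁻¹ * (x * z)      ≈⟨ sym (cancel z) ⟩
    z                  ∎
    where
    x⁻¹ = (x ⁻¹) x≉0
    cancel : ∀ w → w ≈ x⁻¹ * (x * w)
    cancel w = sym (trans (sym (*-assoc x⁻¹ x w)) (trans (*-congʳ (*-inverseˡ x x≉0)) (*-identityˡ w)))

  *-cancelʳ-nonZero : AlmostRightCancellative _≈_ 0# _*_
  *-cancelʳ-nonZero = comm∧almostCancelˡ⇒almostCancelʳ setoid *-comm *-cancelˡ-nonZero

  x*y≈0⇒y≈0 : ∀ {x y} → ¬ x ≈ 0# → x * y ≈ 0# → y ≈ 0#
  x*y≈0⇒y≈0 {x} {y} x≉0 xy≈0 = *-cancelˡ-nonZero x y 0# x≉0 (trans xy≈0 (sym (zeroʳ x)))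

  x*y≈0⇒x≈0⊎y≈0 : ∀ {x y} → x * y ≈ 0# → x ≈ 0# ⊎ y ≈ 0#
  x*y≈0⇒x≈0⊎y≈0 {x} xy≈0 with x ≟ 0#
  ... | yes x≈0 = inj₁ x≈0
  ... | no x≉0 = inj₂ (x*y≈0⇒y≈0 x≉0 xy≈0)

  ^≈0⇒≈0 : ∀ {x} k → x ^ k ≈ 0# → x ≈ 0#
  ^≈0⇒≈0 zero eq = ⊥-elim (0≉1 (sym eq))
  ^≈0⇒≈0 {x} (suc k) eq with x ≟ 0#
  ... | yes x≈0 = x≈0
  ... | no x≉0 = ^≈0⇒≈0 k (x*y≈0⇒y≈0 x≉0 eq)

  permutationOf : (f g : Carrier → Carrier) →
                  (∀ {x y} → x ≈ y → f x ≈ f y) → (∀ {x y} → x ≈ y → g x ≈ g y) →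
                  (∀ x → f (g x) ≈ x) → (∀ x → g (f x) ≈ x) → Permutation n n
  permutationOf f g f-cong g-cong fg gf = permutation (along f) (along g)
    (λ i → enum-inj _ _ (inverse-along f g f-cong fg i))
    (λ i → enum-inj _ _ (inverse-along g f g-cong gf i))
    where
    along : (Carrier → Carrier) → Fin n → Fin n
    along h i = index (h (enum i))
    inverse-along : ∀ h k → (∀ {x y} → x ≈ y → h x ≈ h y) → (∀ x → h (k x) ≈ x) →
                    ∀ i → enum (along h (along k i)) ≈ enum i
    inverse-along h k h-cong hk i =
      trans (enum-index _) (trans (h-cong (enum-index _)) (hk (enum i)))

  characteristic : n · 1# ≈ 0#
  characteristic = identityʳ-unique (∑ enum) (n · 1#) (sym (begin
    ∑ enum                                ≈⟨ ∑.sum-permute enum translation ⟩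
    ∑ (λ i → enum (index (enum i + 1#)))  ≈⟨ ∑.sum-cong-≋ {n} (λ i → enum-index _) ⟩
    ∑ (λ i → enum i + 1#)                 ≈⟨ ∑.∑-distrib-+ {n} enum (λ _ → 1#) ⟩
    ∑ enum + ∑ {n} (λ _ → 1#)             ≈⟨ +-congˡ (∑.sum-replicate n) ⟩
    ∑ enum + n · 1#                       ∎))
    where
    open AbelianGroupProperties +-abelianGroup using (identityʳ-unique)
    shift : ∀ {s t} → s + t ≈ 0# → ∀ x → (x + t) + s ≈ x
    shift {s} {t} s+t≈0 x = trans (+-assoc x t s) (trans (+-congˡ (trans (+-comm t s) s+t≈0)) (+-identityʳ x))
    translation : Permutation n n
    translation = permutationOf (_+ 1#) (_+ - 1#) +-congʳ +-congʳ (shift (-‿inverseʳ 1#)) (shift (-‿inverseˡ 1#))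

  ∏-nonzero : ∀ {k} (f : Fin k → Carrier) → (∀ i → ¬ f i ≈ 0#) → ¬ ∏ f ≈ 0#
  ∏-nonzero {zero} f _ ∏≈0 = 0≉1 (sym ∏≈0)
  ∏-nonzero {suc k} f f≉0 ∏≈0 =
    ∏-nonzero (f ∘ Fin.suc) (f≉0 ∘ Fin.suc) (x*y≈0⇒y≈0 (f≉0 Fin.zero) ∏≈0)

  private
    select : ∀ {y} → Dec (y ≈ 0#) → Carrier → Carrier → Carrier
    select (yes _) a b = a
    select (no _)  a b = b

  unitPart : Carrier → Carrier
  unitPart y = select (y ≟ 0#) 1# y

  atZero : Carrier → Carrier → Carrier
  atZero a y = select (y ≟ 0#) a 1#

  unitPart-cong : ∀ {y z} → y ≈ z → unitPart y ≈ unitPart z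
  unitPart-cong {y} {z} y≈z with y ≟ 0# | z ≟ 0#
  ... | yes _   | yes _   = refl
  ... | yes y≈0 | no z≉0  = ⊥-elim (z≉0 (trans (sym y≈z) y≈0))
  ... | no y≉0  | yes z≈0 = ⊥-elim (y≉0 (trans y≈z z≈0))
  ... | no _    | no _    = y≈z

  unitPart-nonzero : ∀ y → ¬ unitPart y ≈ 0#
  unitPart-nonzero y with y ≟ 0#
  ... | yes _ = λ 1≈0 → 0≉1 (sym 1≈0)
  ... | no y≉0 = y≉0

  *-unitPart : ∀ {x} → ¬ x ≈ 0# → ∀ y → x * unitPart y ≈ unitPart (x * y) * atZero x y
  *-unitPart {x} x≉0 y with y ≟ 0# | x * y ≟ 0#
  ... | yes _   | yes _     = trans (*-identityʳ x) (sym (*-identityˡ x))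
  ... | yes y≈0 | no xy≉0   = ⊥-elim (xy≉0 (trans (*-congˡ y≈0) (zeroʳ x)))
  ... | no y≉0  | yes xy≈0  = ⊥-elim (y≉0 (x*y≈0⇒y≈0 x≉0 xy≈0))
  ... | no _    | no _      = sym (*-identityʳ _)

  ∏-atZero : ∀ {k} a (e : Fin k → Carrier) → (∀ i j → e i ≈ e j → i ≡ j) →
             ∀ i₀ → e i₀ ≈ 0# → ∏ (atZero a ∘ e) ≈ a
  ∏-atZero {suc k} a e e-inj i₀ eᵢ₀≈0 = begin
    ∏ (atZero a ∘ e)                                 ≈⟨ ∏.sum-remove {i = i₀} (atZero a ∘ e) ⟩
    atZero a (e i₀) * ∏ (removeAt (atZero a ∘ e) i₀) ≈⟨ *-cong at-i₀ (trans (∏.sum-cong-≋ {k} elsewhere)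
                                                                         (∏.sum-replicate-zero k)) ⟩
    a * 1#                                           ≈⟨ *-identityʳ a ⟩
    a                                                ∎
    where
    at-i₀ : atZero a (e i₀) ≈ a
    at-i₀ with e i₀ ≟ 0#
    ... | yes _ = refl
    ... | no eᵢ₀≉0 = ⊥-elim (eᵢ₀≉0 eᵢ₀≈0)
    elsewhere : ∀ j → atZero a (e (Fin.punchIn i₀ j)) ≈ 1#
    elsewhere j with e (Fin.punchIn i₀ j) ≟ 0#
    ... | yes e≈0 = ⊥-elim (Fin.punchInᵢ≢i i₀ j (e-inj _ _ (trans e≈0 (sym eᵢ₀≈0))))
    ... | no _ = refl

  ∏-unitPart-scaled : ∀ {x} → ¬ x ≈ 0# → ∏ (λ i → unitPart (x * enum i)) ≈ ∏ (unitPart ∘ enum)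
  ∏-unitPart-scaled {x} x≉0 = sym (trans (∏.sum-permute (unitPart ∘ enum) scaling)
                                         (∏.sum-cong-≋ {n} (λ i → unitPart-cong (enum-index _))))
    where
    x⁻¹ = (x ⁻¹) x≉0
    cancel : ∀ {s t} → s * t ≈ 1# → ∀ y → s * (t * y) ≈ y
    cancel st≈1 y = trans (sym (*-assoc _ _ y)) (trans (*-congʳ st≈1) (*-identityˡ y))
    scaling : Permutation n n
    scaling = permutationOf (x *_) (x⁻¹ *_) *-congˡ *-congˡ (cancel (*-inverseʳ x x≉0)) (cancel (*-inverseˡ x x≉0))

  0^-nonempty : ∀ {k} → Fin k → 0# ^ k ≈ 0#
  0^-nonempty {suc k} _ = zeroˡ _

  -- Scaling by x ≉ 0 permutes the field, and changes unitPart only at 0, where atZero records the lost factor x.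
  fermat : ∀ x → x ^ n ≈ x
  fermat x with x ≟ 0#
  ... | yes x≈0 = trans (^-congˡ n x≈0) (trans (0^-nonempty (index 0#)) (sym x≈0))
  ... | no x≉0 = *-cancelʳ-nonZero U (x ^ n) x (∏-nonzero (unitPart ∘ enum) (unitPart-nonzero ∘ enum)) (begin
    x ^ n * U                               ≈⟨ *-congʳ (sym (∏.sum-replicate n)) ⟩
    ∏ {n} (λ _ → x) * U                     ≈⟨ sym (∏.∑-distrib-+ {n} (λ _ → x) (unitPart ∘ enum)) ⟩
    ∏ (λ i → x * unitPart (enum i))         ≈⟨ ∏.sum-cong-≋ {n} (*-unitPart x≉0 ∘ enum) ⟩
    ∏ (λ i → scaled i * atZero x (enum i))  ≈⟨ ∏.∑-distrib-+ {n} scaled (atZero x ∘ enum) ⟩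
    ∏ scaled * ∏ (atZero x ∘ enum)          ≈⟨ *-cong (∏-unitPart-scaled x≉0)
                                                      (∏-atZero x enum enum-inj (index 0#) (enum-index 0#)) ⟩
    U * x                                   ≈⟨ *-comm U x ⟩
    x * U                                   ∎)
    where
    U : Carrier
    U = ∏ (unitPart ∘ enum)
    scaled : Fin n → Carrier
    scaled i = unitPart (x * enum i)

module Polynomial {c ℓ} (R : CommutativeRing c ℓ)
  (*-cancelˡ-nonZero : AlmostLeftCancellative (CommutativeRing._≈_ R) (CommutativeRing.0# R) (CommutativeRing._*_ R)) where
  open CommutativeRing R
  open NaturalSolver commutativeSemiring using (solve; _:=_; _:+_; _:*_; con)
  open AbelianGroupProperties +-abelianGroup using (x∙y⁻¹≈ε⇒x≈y; ∙-cancelˡ)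
  open RingProperties ring using (-‿distribˡ-*)
  open import Relation.Binary.Reasoning.Setoid setoid

  eval : List Carrier → Carrier → Carrier
  eval []       x = 0#
  eval (d ∷ ds) x = d + x * eval ds x

  divide : Carrier → List Carrier → List Carrier
  divide r []           = []
  divide r (d ∷ [])     = []
  divide r (d ∷ e ∷ es) = eval (e ∷ es) r ∷ divide r (e ∷ es)

  length-divide : ∀ r d ds → length (divide r (d ∷ ds)) ≡ length ds
  length-divide r d []       = ≡.refl
  length-divide r d (e ∷ es) = ≡.cong suc (length-divide r e es)

  -- p(x) - p(r) = (x - r) q(x) for q = divide r p, with both sides moved so that no subtraction occurs.
  eval-divide : ∀ r p x → eval p x + r * eval (divide r p) x ≈ eval p r + x * eval (divide r p) x
  eval-divide r [] x = solve 2 (λ r x → con 0 :+ r :* con 0 := con 0 :+ x :* con 0) refl r x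
  eval-divide r (d ∷ []) x =
    solve 3 (λ d r x → (d :+ x :* con 0) :+ r :* con 0 := (d :+ r :* con 0) :+ x :* con 0) refl d r x
  eval-divide r (d ∷ e ∷ es) x = begin
    (d + x * P) + r * (A + x * Q) ≈⟨ solve 6 (λ d r x P A Q → (d :+ x :* P) :+ r :* (A :+ x :* Q)
                                          := (d :+ r :* A) :+ x :* (P :+ r :* Q)) refl d r x P A Q ⟩
    (d + r * A) + x * (P + r * Q) ≈⟨ +-congˡ (*-congˡ (eval-divide r (e ∷ es) x)) ⟩
    (d + r * A) + x * (A + x * Q) ∎
    where
    P = eval (e ∷ es) x
    A = eval (e ∷ es) r
    Q = eval (divide r (e ∷ es)) x

  *-cancelʳ-distinct : ∀ {r s y} → ¬ r ≈ s → r * y ≈ s * y → y ≈ 0#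
  *-cancelʳ-distinct {r} {s} {y} r≉s ry≈sy =
    *-cancelˡ-nonZero (r - s) y 0# (λ r-s≈0 → r≉s (x∙y⁻¹≈ε⇒x≈y r s r-s≈0)) (begin
      (r - s) * y        ≈⟨ distribʳ y r (- s) ⟩
      r * y + - s * y    ≈⟨ +-cong ry≈sy (sym (-‿distribˡ-* s y)) ⟩
      s * y + - (s * y)  ≈⟨ -‿inverseʳ (s * y) ⟩
      0#                 ≈⟨ sym (zeroʳ (r - s)) ⟩
      (r - s) * 0#       ∎)

  divide-zero : ∀ r p → All (_≈ 0#) (divide r p) → eval p r ≈ 0# → All (_≈ 0#) p
  divide-zero r [] _ _ = []
  divide-zero r (d ∷ []) _ p[r]≈0 =
    trans (sym (trans (+-congˡ (zeroʳ r)) (+-identityʳ d))) p[r]≈0 ∷ []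
  divide-zero r (d ∷ e ∷ es) (A≈0 ∷ q≈0) p[r]≈0 =
    trans (sym (trans (+-congˡ (trans (*-congˡ A≈0) (zeroʳ r))) (+-identityʳ d))) p[r]≈0
    ∷ divide-zero r (e ∷ es) q≈0 A≈0

  roots⇒zero : ∀ k p → length p ≤ k → (rs : Fin k → Carrier) → (∀ i j → rs i ≈ rs j → i ≡ j) →
               (∀ i → eval p (rs i) ≈ 0#) → All (_≈ 0#) p
  roots⇒zero k [] _ _ _ _ = []
  roots⇒zero (suc k) (d ∷ ds) (s≤s ds≤k) rs rs-inj rs-roots =
    divide-zero r (d ∷ ds)
      (roots⇒zero k (divide r (d ∷ ds)) (≡.subst (_≤ k) (≡.sym (length-divide r d ds)) ds≤k)
        (rs ∘ Fin.suc) (λ i j eq → Fin.suc-injective (rs-inj _ _ eq)) q-roots)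
      (rs-roots Fin.zero)
    where
    r = rs Fin.zero
    q-roots : ∀ j → eval (divide r (d ∷ ds)) (rs (Fin.suc j)) ≈ 0#
    q-roots j = *-cancelʳ-distinct (λ r≈s → Fin.0≢1+n (rs-inj _ _ r≈s)) (∙-cancelˡ (eval (d ∷ ds) s) _ _ (begin
      eval (d ∷ ds) s + r * eval (divide r (d ∷ ds)) s ≈⟨ eval-divide r (d ∷ ds) s ⟩
      eval (d ∷ ds) r + s * eval (divide r (d ∷ ds)) s ≈⟨ +-congʳ (trans (rs-roots Fin.zero) (sym (rs-roots (Fin.suc j)))) ⟩
      eval (d ∷ ds) s + s * eval (divide r (d ∷ ds)) s ∎))
      where s = rs (Fin.suc j)

  spread : List Carrier → List Carrier
  spread []       = []
  spread (d ∷ ds) = d ∷ 0# ∷ spread ds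

  eval-spread : ∀ p x → eval (spread p) x ≈ eval p (x * x)
  eval-spread [] x = refl
  eval-spread (d ∷ ds) x = begin
    d + x * (0# + x * eval (spread ds) x) ≈⟨ +-congˡ (*-congˡ (+-congˡ (*-congˡ (eval-spread ds x)))) ⟩
    d + x * (0# + x * eval ds (x * x))    ≈⟨ solve 3 (λ d x E → d :+ x :* (con 0 :+ x :* E) := d :+ (x :* x) :* E) refl d x _ ⟩
    d + (x * x) * eval ds (x * x)         ∎

  length-spread : ∀ p → length (spread p) ≡ length p +ℕ length p
  length-spread [] = ≡.refl
  length-spread (d ∷ ds) = ≡.cong suc (≡.trans (≡.cong suc (length-spread ds)) (≡.sym (ℕ.+-suc _ _)))

HasCharacteristic2 : ∀ {c ℓ} → CommutativeRing c ℓ → Set ℓ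
HasCharacteristic2 R = 1# + 1# ≈ 0#
  where open CommutativeRing R

module Characteristic2 {c ℓ} (R : CommutativeRing c ℓ) (1+1≈0 : HasCharacteristic2 R) where
  open CommutativeRing R
  open Exp semiring using (_^_; ^-congˡ; ^-assocʳ)
  open AbelianGroupProperties +-abelianGroup using (inverseʳ-unique; ε⁻¹≈ε)
  open import Relation.Binary.Reasoning.Setoid setoid

  𝔽₂ : RawRing _ _
  𝔽₂ = record { Carrier = Bool ; _≈_ = _≡_ ; _+_ = _xor_ ; _*_ = _∧_ ; -_ = λ b → b ; 0# = false ; 1# = true }

  ⟦_⟧ : Bool → Carrier
  ⟦ true ⟧  = 1#
  ⟦ false ⟧ = 0#

  𝔽₂-morphism : 𝔽₂ -Raw-AlmostCommutative⟶ fromCommutativeRing R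
  𝔽₂-morphism = record
    { ⟦_⟧    = ⟦_⟧
    ; +-homo = λ { true true → sym 1+1≈0 ; true false → sym (+-identityʳ _)
                 ; false true → sym (+-identityˡ _) ; false false → sym (+-identityˡ _) }
    ; *-homo = λ { true true → sym (*-identityˡ _) ; true false → sym (zeroʳ _)
                 ; false true → sym (zeroˡ _) ; false false → sym (zeroˡ _) }
    ; -‿homo = λ { true → inverseʳ-unique 1# 1# 1+1≈0 ; false → sym ε⁻¹≈ε }
    ; 0-homo = refl
    ; 1-homo = refl
    }

  ⟦⟧-≟ : (x y : Bool) → Maybe (⟦ x ⟧ ≈ ⟦ y ⟧)
  ⟦⟧-≟ true  true  = just refl
  ⟦⟧-≟ false false = just refl
  ⟦⟧-≟ _     _     = nothing

  open Algebra.Solver.Ring 𝔽₂ (fromCommutativeRing R) 𝔽₂-morphism ⟦⟧-≟ public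
    using (solve; _:=_; _:+_; _:*_; _:^_; con)

  x+y≈0⇒x≈y : ∀ {x y} → x + y ≈ 0# → x ≈ y
  x+y≈0⇒x≈y {x} {y} x+y≈0 = begin
    x             ≈⟨ solve 2 (λ x y → x := (x :+ y) :+ y) refl x y ⟩
    (x + y) + y   ≈⟨ +-congʳ x+y≈0 ⟩
    0# + y        ≈⟨ +-identityˡ y ⟩
    y             ∎

  x≈y⇒x+y≈0 : ∀ {x y} → x ≈ y → x + y ≈ 0#
  x≈y⇒x+y≈0 {x} {y} x≈y = trans (+-congʳ x≈y) (solve 1 (λ y → y :+ y := con false) refl y)

  +-^-2^ : ∀ k x y → (x + y) ^ (2 ^ℕ k) ≈ x ^ (2 ^ℕ k) + y ^ (2 ^ℕ k)
  +-^-2^ zero x y = solve 2 (λ x y → (x :+ y) :^ 1 := x :^ 1 :+ y :^ 1) refl x y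
  +-^-2^ (suc k) x y = begin
    (x + y) ^ (2 *ℕ 2 ^ℕ k)           ≈⟨ sym (^-assocʳ (x + y) 2 (2 ^ℕ k)) ⟩
    ((x + y) ^ 2) ^ (2 ^ℕ k)           ≈⟨ ^-congˡ (2 ^ℕ k) (solve 2 (λ x y → (x :+ y) :^ 2 := x :^ 2 :+ y :^ 2) refl x y) ⟩
    (x ^ 2 + y ^ 2) ^ (2 ^ℕ k)         ≈⟨ +-^-2^ k (x ^ 2) (y ^ 2) ⟩
    (x ^ 2) ^ (2 ^ℕ k) + (y ^ 2) ^ (2 ^ℕ k) ≈⟨ +-cong (^-assocʳ x 2 (2 ^ℕ k)) (^-assocʳ y 2 (2 ^ℕ k)) ⟩
    x ^ (2 *ℕ 2 ^ℕ k) + y ^ (2 *ℕ 2 ^ℕ k) ∎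

module Traces {ℓ₁ ℓ₂} (m : ℕ) (1≤m : 1 ≤ m) (K2 : FieldOfOrder (2 ^ℕ (2 *ℕ m)) ℓ₁ ℓ₂) where
  open FieldOfOrder K2
  open Setting m K2
  open FiniteField K2 public
  open Exp semiring using (_^_; ^-congˡ; ^-assocʳ)
  open CommutativeSemiringExp commutativeSemiring using (^-distrib-*)
  open Mult semiring using (×1-homo-*) renaming (_×_ to _·_)
  open import Algebra.Properties.CommutativeSemigroup +-commutativeSemigroup using () renaming (interchange to +-interchange)
  open import Relation.Binary.Reasoning.Setoid setoid

  1+1≈0 : 1# + 1# ≈ 0#
  1+1≈0 = ^≈0⇒≈0 (2 *ℕ m) (trans (sym (2^·1≈2^ (2 *ℕ m))) characteristic)
    where
    2^·1≈2^ : ∀ k → (2 ^ℕ k) · 1# ≈ (1# + 1#) ^ k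
    2^·1≈2^ zero = +-identityʳ 1#
    2^·1≈2^ (suc k) = trans (×1-homo-* 2 (2 ^ℕ k)) (*-cong (+-congˡ (+-identityʳ 1#)) (2^·1≈2^ k))

  open Characteristic2 cring 1+1≈0 public

  pow≈^ : ∀ x k → pow x k ≈ x ^ k
  pow≈^ x zero    = refl
  pow≈^ x (suc k) = *-congˡ (pow≈^ x k)

  pow-cong : ∀ {x y} k → x ≈ y → pow x k ≈ pow y k
  pow-cong {x} {y} k x≈y = trans (pow≈^ x k) (trans (^-congˡ k x≈y) (sym (pow≈^ y k)))

  pow-assoc : ∀ x i j → pow (pow x i) j ≈ pow x (i *ℕ j)
  pow-assoc x i j = begin
    pow (pow x i) j  ≈⟨ pow≈^ (pow x i) j ⟩
    pow x i ^ j      ≈⟨ ^-congˡ j (pow≈^ x i) ⟩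
    (x ^ i) ^ j      ≈⟨ ^-assocʳ x i j ⟩
    x ^ (i *ℕ j)     ≈⟨ sym (pow≈^ x (i *ℕ j)) ⟩
    pow x (i *ℕ j)   ∎

  pow-distrib-* : ∀ x y k → pow (x * y) k ≈ pow x k * pow y k
  pow-distrib-* x y k = trans (pow≈^ (x * y) k) (trans (^-distrib-* x y k) (sym (*-cong (pow≈^ x k) (pow≈^ y k))))

  pow-2^-+ : ∀ k x y → pow (x + y) (2 ^ℕ k) ≈ pow x (2 ^ℕ k) + pow y (2 ^ℕ k)
  pow-2^-+ k x y = trans (pow≈^ (x + y) (2 ^ℕ k)) (trans (+-^-2^ k x y) (sym (+-cong (pow≈^ x (2 ^ℕ k)) (pow≈^ y (2 ^ℕ k)))))

  0-pow-2^ : ∀ k → pow 0# (2 ^ℕ k) ≈ 0#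
  0-pow-2^ k with 2 ^ℕ k | ℕ.m^n>0 2 k
  ... | suc _ | _ = zeroˡ _

  fermat-pow : ∀ x → pow x (q *ℕ q) ≈ x
  fermat-pow x = begin
    pow x (q *ℕ q)         ≡⟨ ≡.cong (pow x) (≡.sym (ℕ.^-distribˡ-+-* 2 m m)) ⟩
    pow x (2 ^ℕ (m +ℕ m))  ≡⟨ ≡.cong (λ k → pow x (2 ^ℕ (m +ℕ k))) (≡.sym (ℕ.+-identityʳ m)) ⟩
    pow x (2 ^ℕ (2 *ℕ m))  ≈⟨ pow≈^ x (2 ^ℕ (2 *ℕ m)) ⟩
    x ^ (2 ^ℕ (2 *ℕ m))    ≈⟨ fermat x ⟩
    x                      ∎

  φ : Carrier → Carrier
  φ x = pow x q

  φ-cong : ∀ {x y} → x ≈ y → φ x ≈ φ y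
  φ-cong = pow-cong q

  φ-+ : ∀ x y → φ (x + y) ≈ φ x + φ y
  φ-+ = pow-2^-+ m

  φ-* : ∀ x y → φ (x * y) ≈ φ x * φ y
  φ-* x y = pow-distrib-* x y q

  φ-pow : ∀ x k → φ (pow x k) ≈ pow (φ x) k
  φ-pow x k = begin
    pow (pow x k) q  ≈⟨ pow-assoc x k q ⟩
    pow x (k *ℕ q)   ≡⟨ ≡.cong (pow x) (ℕ.*-comm k q) ⟩
    pow x (q *ℕ k)   ≈⟨ sym (pow-assoc x q k) ⟩
    pow (pow x q) k  ∎

  φ-involutive : ∀ x → φ (φ x) ≈ x
  φ-involutive x = trans (pow-assoc x q q) (fermat-pow x)

  inK-+ : ∀ {x y} → inK x → inK y → inK (x + y)
  inK-+ {x} {y} x∈K y∈K = trans (φ-+ x y) (+-cong x∈K y∈K)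

  inK-* : ∀ {x y} → inK x → inK y → inK (x * y)
  inK-* {x} {y} x∈K y∈K = trans (φ-* x y) (*-cong x∈K y∈K)

  inK-pow : ∀ {x} k → inK x → inK (pow x k)
  inK-pow {x} k x∈K = trans (φ-pow x k) (pow-cong k x∈K)

  inK-⁻¹ : ∀ {x} (x≉0 : ¬ x ≈ 0#) → inK x → inK ((x ⁻¹) x≉0)
  inK-⁻¹ {x} x≉0 x∈K = *-cancelʳ-nonZero x (φ x⁻¹) x⁻¹ x≉0 (begin
    φ x⁻¹ * x      ≈⟨ *-congˡ (sym x∈K) ⟩
    φ x⁻¹ * φ x    ≈⟨ sym (φ-* x⁻¹ x) ⟩
    φ (x⁻¹ * x)    ≈⟨ φ-cong x⁻¹x≈1 ⟩
    φ 1#           ≈⟨ trans (pow≈^ 1# q) (×-idem (*-identityʳ 1#) q {{ℕ.m^n≢0 2 m}}) ⟩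
    1#             ≈⟨ sym x⁻¹x≈1 ⟩
    x⁻¹ * x        ∎)
    where
    open import Algebra.Properties.Monoid.Mult *-monoid using (×-idem)
    x⁻¹ = (x ⁻¹) x≉0
    x⁻¹x≈1 = *-inverseˡ x x≉0

  inK-Tr-rel : ∀ u → inK (Tr-rel u)
  inK-Tr-rel u = trans (φ-+ u (φ u)) (trans (+-congˡ (φ-involutive u)) (+-comm (φ u) u))

  sumTo-cong : ∀ k {f g : ℕ → Carrier} → (∀ i → f i ≈ g i) → sumTo k f ≈ sumTo k g
  sumTo-cong zero    f≈g = refl
  sumTo-cong (suc k) f≈g = +-cong (sumTo-cong k f≈g) (f≈g k)

  sumTo-zero : ∀ k {f : ℕ → Carrier} → (∀ i → f i ≈ 0#) → sumTo k f ≈ 0#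
  sumTo-zero zero    f≈0 = refl
  sumTo-zero (suc k) f≈0 = trans (+-cong (sumTo-zero k f≈0) (f≈0 k)) (+-identityˡ 0#)

  sumTo-+ : ∀ k (f g : ℕ → Carrier) → sumTo k (λ i → f i + g i) ≈ sumTo k f + sumTo k g
  sumTo-+ zero    f g = sym (+-identityˡ 0#)
  sumTo-+ (suc k) f g = trans (+-congʳ (sumTo-+ k f g)) (+-interchange _ _ _ _)

  sumTo-split : ∀ j k (f : ℕ → Carrier) → sumTo (j +ℕ k) f ≈ sumTo j f + sumTo k (λ i → f (j +ℕ i))
  sumTo-split j zero f =
    trans (reflexive (≡.cong (λ t → sumTo t f) (ℕ.+-identityʳ j))) (sym (+-identityʳ _))
  sumTo-split j (suc k) f = begin
    sumTo (j +ℕ suc k) f                                      ≡⟨ ≡.cong (λ t → sumTo t f) (ℕ.+-suc j k) ⟩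
    sumTo (j +ℕ k) f + f (j +ℕ k)                             ≈⟨ +-congʳ (sumTo-split j k f) ⟩
    (sumTo j f + sumTo k (λ i → f (j +ℕ i))) + f (j +ℕ k)     ≈⟨ +-assoc _ _ _ ⟩
    sumTo j f + (sumTo k (λ i → f (j +ℕ i)) + f (j +ℕ k))     ∎

  sumTo-suc : ∀ k (f : ℕ → Carrier) → sumTo (suc k) f ≈ f 0 + sumTo k (λ i → f (suc i))
  sumTo-suc zero    f = trans (+-identityˡ _) (sym (+-identityʳ _))
  sumTo-suc (suc k) f = trans (+-congʳ (sumTo-suc k f)) (+-assoc _ _ _)

  sumTo-telescope : ∀ k (f : ℕ → Carrier) → sumTo k (λ i → f (suc i)) + sumTo k f ≈ f k + f 0
  sumTo-telescope zero f = trans (+-identityˡ 0#) (sym (x≈y⇒x+y≈0 refl))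
  sumTo-telescope (suc k) f = begin
    (sumTo k (f ∘ suc) + f (suc k)) + (sumTo k f + f k) ≈⟨ +-interchange _ _ _ _ ⟩
    (sumTo k (f ∘ suc) + sumTo k f) + (f (suc k) + f k) ≈⟨ +-congʳ (sumTo-telescope k f) ⟩
    (f k + f 0) + (f (suc k) + f k)                     ≈⟨ solve 3 (λ a b c → (a :+ b) :+ (c :+ a) := c :+ b) refl _ _ _ ⟩
    f (suc k) + f 0                                     ∎

  Tr-k-cong : ∀ {x y} → x ≈ y → Tr-k x ≈ Tr-k y
  Tr-k-cong x≈y = sumTo-cong m (λ i → pow-cong (2 ^ℕ i) x≈y)

  Tr-k-+ : ∀ x y → Tr-k (x + y) ≈ Tr-k x + Tr-k y
  Tr-k-+ x y = trans (sumTo-cong m (λ i → pow-2^-+ i x y)) (sumTo-+ m _ _)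

  Tr-k-0 : Tr-k 0# ≈ 0#
  Tr-k-0 = sumTo-zero m 0-pow-2^

  Tr-k2≈Tr-k∘Tr-rel : ∀ x → Tr-k2 x ≈ Tr-k (Tr-rel x)
  Tr-k2≈Tr-k∘Tr-rel x = begin
    sumTo (m +ℕ (m +ℕ 0)) f      ≡⟨ ≡.cong (λ t → sumTo (m +ℕ t) f) (ℕ.+-identityʳ m) ⟩
    sumTo (m +ℕ m) f             ≈⟨ sumTo-split m m f ⟩
    Tr-k x + sumTo m (λ i → f (m +ℕ i)) ≈⟨ +-congˡ (sumTo-cong m shifted) ⟩
    Tr-k x + Tr-k (φ x)          ≈⟨ sym (Tr-k-+ x (φ x)) ⟩
    Tr-k (Tr-rel x)              ∎
    where
    f : ℕ → Carrier
    f i = pow x (2 ^ℕ i)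
    shifted : ∀ i → f (m +ℕ i) ≈ pow (φ x) (2 ^ℕ i)
    shifted i = trans (reflexive (≡.cong (pow x) (ℕ.^-distribˡ-+-* 2 m i))) (sym (pow-assoc x q (2 ^ℕ i)))

  Tr-k-x²+x : ∀ x → Tr-k (pow x 2 + x) ≈ φ x + x
  Tr-k-x²+x x = begin
    Tr-k (pow x 2 + x)                       ≈⟨ Tr-k-+ (pow x 2) x ⟩
    Tr-k (pow x 2) + Tr-k x                  ≈⟨ +-congʳ (sumTo-cong m (λ i → pow-assoc x 2 (2 ^ℕ i))) ⟩
    sumTo m (λ i → f (suc i)) + sumTo m f    ≈⟨ sumTo-telescope m f ⟩
    φ x + pow x 1                            ≈⟨ +-congˡ (*-identityʳ x) ⟩
    φ x + x                                  ∎
    where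
    f : ℕ → Carrier
    f i = pow x (2 ^ℕ i)

  Tr-k-+-cong : ∀ {x x′ y y′} → Tr-k x ≈ Tr-k x′ → Tr-k y ≈ Tr-k y′ → Tr-k (x + y) ≈ Tr-k (x′ + y′)
  Tr-k-+-cong {x} {x′} {y} {y′} Tx≈Tx′ Ty≈Ty′ =
    trans (Tr-k-+ x y) (trans (+-cong Tx≈Tx′ Ty≈Ty′) (sym (Tr-k-+ x′ y′)))

  Tr-k-square : ∀ {y} → inK y → Tr-k (pow y 2) ≈ Tr-k y
  Tr-k-square {y} y∈K = x+y≈0⇒x≈y (begin
    Tr-k (pow y 2) + Tr-k y  ≈⟨ sym (Tr-k-+ (pow y 2) y) ⟩
    Tr-k (pow y 2 + y)       ≈⟨ Tr-k-x²+x y ⟩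
    φ y + y                  ≈⟨ x≈y⇒x+y≈0 y∈K ⟩
    0#                       ∎)

  Tr-k-fourth : ∀ {y} → inK y → Tr-k (pow y 4) ≈ Tr-k y
  Tr-k-fourth {y} y∈K = begin
    Tr-k (pow y 4)            ≈⟨ Tr-k-cong (solve 1 (λ y → y :^ 4 := (y :^ 2) :^ 2) refl y) ⟩
    Tr-k (pow (pow y 2) 2)    ≈⟨ Tr-k-square (inK-pow 2 y∈K) ⟩
    Tr-k (pow y 2)            ≈⟨ Tr-k-square y∈K ⟩
    Tr-k y                    ∎

  open Polynomial cring *-cancelˡ-nonZero using (eval; spread; eval-spread; length-spread; roots⇒zero)

  traceQuotient : ℕ → List Carrier
  traceQuotient zero    = 1# ∷ []
  traceQuotient (suc K) = 1# ∷ spread (traceQuotient K)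

  eval-traceQuotient : ∀ K x → x * eval (traceQuotient K) x ≈ sumTo (suc K) (λ i → pow x (2 ^ℕ i))
  eval-traceQuotient zero x = solve 1 (λ x → x :* (con true :+ x :* con false) := con false :+ x :* con true) refl x
  eval-traceQuotient (suc K) x = begin
    x * (1# + x * eval (spread (traceQuotient K)) x) ≈⟨ *-congˡ (+-congˡ (*-congˡ (eval-spread (traceQuotient K) x))) ⟩
    x * (1# + x * eval (traceQuotient K) (x * x))    ≈⟨ solve 2 (λ x T → x :* (con true :+ x :* T) := x :+ (x :* x) :* T)
                                                          refl x _ ⟩
    x + (x * x) * eval (traceQuotient K) (x * x)     ≈⟨ +-cong (sym (*-identityʳ x)) (eval-traceQuotient K (x * x)) ⟩
    pow x 1 + sumTo (suc K) (λ i → pow (x * x) (2 ^ℕ i)) ≈⟨ +-congˡ (sumTo-cong (suc K) squared) ⟩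
    pow x 1 + sumTo (suc K) (λ i → pow x (2 ^ℕ suc i))   ≈⟨ sym (sumTo-suc (suc K) (λ i → pow x (2 ^ℕ i))) ⟩
    sumTo (suc (suc K)) (λ i → pow x (2 ^ℕ i))           ∎
    where
    squared : ∀ i → pow (x * x) (2 ^ℕ i) ≈ pow x (2 ^ℕ suc i)
    squared i = trans (pow-cong (2 ^ℕ i) (*-congˡ (sym (*-identityʳ x)))) (pow-assoc x 2 (2 ^ℕ i))

  length-traceQuotient : ∀ K → suc (length (traceQuotient K)) ≡ 2 ^ℕ suc K
  length-traceQuotient zero = ≡.refl
  length-traceQuotient (suc K) =
    ≡.trans (≡.cong (suc ∘ suc) (length-spread (traceQuotient K))) (doubled _ _ (length-traceQuotient K))
    where
    doubled : ∀ L t → suc L ≡ t → suc (suc (L +ℕ L)) ≡ t +ℕ (t +ℕ 0)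
    doubled L _ ≡.refl = ≡.cong suc (≡.trans (≡.sym (ℕ.+-suc L L)) (≡.cong (L +ℕ_) (≡.sym (ℕ.+-identityʳ (suc L)))))

  traceQuotient-nonzero : ∀ K → ¬ All (_≈ 0#) (traceQuotient K)
  traceQuotient-nonzero zero    (1≈0 ∷ _) = 0≉1 (sym 1≈0)
  traceQuotient-nonzero (suc K) (1≈0 ∷ _) = 0≉1 (sym 1≈0)

  2m-is-suc : ∃ λ K → 2 *ℕ m ≡ suc K
  2m-is-suc = double-positive 1≤m
    where
    double-positive : ∀ {k} → 1 ≤ k → ∃ λ K → 2 *ℕ k ≡ suc K
    double-positive {suc k} _ = _ , ≡.refl

  Tr-k2-not-identically-zero : ¬ (∀ i → Tr-k2 (enum i) ≈ 0#)
  Tr-k2-not-identically-zero Tr≈0 with 2m-is-suc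
  ... | K , 2m≡1+K = traceQuotient-nonzero K (tail-zero (roots⇒zero _ (0# ∷ traceQuotient K) length≤ enum enum-inj roots))
    where
    tail-zero : All (_≈ 0#) (0# ∷ traceQuotient K) → All (_≈ 0#) (traceQuotient K)
    tail-zero (_ ∷ zeros) = zeros
    length≤ : length (0# ∷ traceQuotient K) ≤ 2 ^ℕ (2 *ℕ m)
    length≤ = ℕ.≤-reflexive (≡.trans (length-traceQuotient K) (≡.cong (2 ^ℕ_) (≡.sym 2m≡1+K)))
    roots : ∀ i → eval (0# ∷ traceQuotient K) (enum i) ≈ 0#
    roots i = trans (+-identityˡ _) (trans (eval-traceQuotient K (enum i))
      (trans (reflexive (≡.cong (λ t → sumTo t (λ j → pow (enum i) (2 ^ℕ j))) (≡.sym 2m≡1+K))) (Tr≈0 i)))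

  Tr-k2-nonzero : ∃ λ y → ¬ Tr-k2 y ≈ 0#
  Tr-k2-nonzero with ¬∀⟶∃¬ _ _ (λ i → Tr-k2 (enum i) ≟ 0#) Tr-k2-not-identically-zero
  ... | i , Tr≉0 = enum i , Tr≉0

  Tr-k-nondegenerate : ∀ {e} → inK e → (∀ l → inK l → Tr-k (l * e) ≈ 0#) → e ≈ 0#
  Tr-k-nondegenerate {e} e∈K Tr[le]≈0 with e ≟ 0# | Tr-k2-nonzero
  ... | yes e≈0 | _ = e≈0
  ... | no e≉0 | y , Tr[y]≉0 = ⊥-elim (Tr[y]≉0 (begin
    Tr-k2 y                ≈⟨ Tr-k2≈Tr-k∘Tr-rel y ⟩
    Tr-k μ                 ≈⟨ Tr-k-cong (sym μe⁻¹e≈μ) ⟩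
    Tr-k ((μ * e⁻¹) * e)   ≈⟨ Tr[le]≈0 (μ * e⁻¹) (inK-* (inK-Tr-rel y) (inK-⁻¹ e≉0 e∈K)) ⟩
    0#                     ∎))
    where
    μ = Tr-rel y
    e⁻¹ = (e ⁻¹) e≉0
    μe⁻¹e≈μ : (μ * e⁻¹) * e ≈ μ
    μe⁻¹e≈μ = trans (*-assoc μ e⁻¹ e) (trans (*-congˡ (*-inverseˡ e e≉0)) (*-identityʳ μ))

  fourthRoot : Carrier → Carrier
  fourthRoot y = pow y (2 ^ℕ (2 *ℕ m ∸ 2))

  fourthRoot-spec : ∀ y → pow (fourthRoot y) 4 ≈ y
  fourthRoot-spec y = begin
    pow (pow y (2 ^ℕ (2 *ℕ m ∸ 2))) 4   ≈⟨ pow-assoc y (2 ^ℕ (2 *ℕ m ∸ 2)) 4 ⟩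
    pow y (2 ^ℕ (2 *ℕ m ∸ 2) *ℕ 2 ^ℕ 2) ≡⟨ ≡.cong (pow y) exponent ⟩
    pow y (2 ^ℕ (2 *ℕ m))               ≈⟨ pow≈^ y (2 ^ℕ (2 *ℕ m)) ⟩
    y ^ (2 ^ℕ (2 *ℕ m))                 ≈⟨ fermat y ⟩
    y                                   ∎
    where
    exponent : 2 ^ℕ (2 *ℕ m ∸ 2) *ℕ 2 ^ℕ 2 ≡ 2 ^ℕ (2 *ℕ m)
    exponent = ≡.trans (≡.sym (ℕ.^-distribˡ-+-* 2 (2 *ℕ m ∸ 2) 2))
                       (≡.cong (2 ^ℕ_) (ℕ.m∸n+n≡m (ℕ.*-monoʳ-≤ 2 1≤m)))

  inK-fourthRoot : ∀ {y} → inK y → inK (fourthRoot y)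
  inK-fourthRoot = inK-pow (2 ^ℕ (2 *ℕ m ∸ 2))

  x²+x≈0⇒x≈0⊎x≈1 : ∀ {x} → pow x 2 + x ≈ 0# → x ≈ 0# ⊎ x ≈ 1#
  x²+x≈0⇒x≈0⊎x≈1 {x} x²+x≈0 with x ≟ 0#
  ... | yes x≈0 = inj₁ x≈0
  ... | no x≉0 = inj₂ (x+y≈0⇒x≈y (x*y≈0⇒y≈0 x≉0
      (trans (solve 1 (λ x → x :* (x :+ con true) := x :^ 2 :+ x) refl x) x²+x≈0)))

module QuadraticForm {ℓ₁ ℓ₂} (m : ℕ) (1≤m : 1 ≤ m) (K2 : FieldOfOrder (2 ^ℕ (2 *ℕ m)) ℓ₁ ℓ₂)
  (a b c : FieldOfOrder.Carrier K2)
  (a∈K : Setting.inK m K2 a) (b∈K : Setting.inK m K2 b) (c∈K : Setting.inK m K2 c) where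
  open FieldOfOrder K2
  open Setting m K2
  open Params a b c
  open Traces m 1≤m K2
  open import Relation.Binary.Reasoning.Setoid setoid

  f : Carrier → Carrier
  f x = a * pow x 5 + b * pow x 3 + c * x

  R-+ : ∀ x y → R (x + y) ≈ R x + R y
  R-+ = solve 5 (λ a b c x y →
          a :* (x :+ y) :^ 4 :+ b :* (x :+ y) :^ 2 :+ c :^ 2 :* (x :+ y)
          := (a :* x :^ 4 :+ b :* x :^ 2 :+ c :^ 2 :* x) :+ (a :* y :^ 4 :+ b :* y :^ 2 :+ c :^ 2 :* y))
        refl a b c

  φ-R : ∀ x → φ (R x) ≈ R (φ x)
  φ-R x = trans (φ-+ _ _) (+-cong (trans (φ-+ _ _) (+-cong
      (trans (φ-* _ _) (*-cong a∈K (φ-pow x 4)))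
      (trans (φ-* _ _) (*-cong b∈K (φ-pow x 2)))))
    (trans (φ-* _ _) (*-congʳ (inK-pow 2 c∈K))))

  φ-f : ∀ x → φ (f x) ≈ f (φ x)
  φ-f x = trans (φ-+ _ _) (+-cong (trans (φ-+ _ _) (+-cong
      (trans (φ-* _ _) (*-cong a∈K (φ-pow x 5)))
      (trans (φ-* _ _) (*-cong b∈K (φ-pow x 3)))))
    (trans (φ-* _ _) (*-congʳ c∈K)))

  inK-R : ∀ {x} → inK x → inK (R x)
  inK-R x∈K = inK-+ (inK-+ (inK-* a∈K (inK-pow 4 x∈K)) (inK-* b∈K (inK-pow 2 x∈K))) (inK-* (inK-pow 2 c∈K) x∈K)

  inK-E : ∀ {x} → inK x → inK (E x)
  inK-E x∈K = inK-+ (inK-+ (inK-+ (inK-* (inK-pow 4 a∈K) (inK-pow 16 x∈K)) (inK-* (inK-pow 4 b∈K) (inK-pow 8 x∈K)))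
                            (inK-* (inK-pow 2 b∈K) (inK-pow 2 x∈K)))
                    (inK-* a∈K x∈K)

  pairing≈Tr-k : ∀ u l → inK l → ⟨ u , l ⟩R ≈ Tr-k (Tr-rel u * R l + l * R (Tr-rel u))
  pairing≈Tr-k u l l∈K = trans (Tr-k2≈Tr-k∘Tr-rel X) (Tr-k-cong (begin
    X + φ X                              ≈⟨ +-congˡ φX ⟩
    X + (φ u * R l + l * R (φ u))        ≈⟨ regroup ⟩
    Tr-rel u * R l + l * (R u + R (φ u)) ≈⟨ +-congˡ (*-congˡ (sym (R-+ u (φ u)))) ⟩
    Tr-rel u * R l + l * R (Tr-rel u)    ∎))
    where
    X = u * R l + l * R u
    φX : φ X ≈ φ u * R l + l * R (φ u)
    φX = trans (φ-+ _ _) (+-cong (trans (φ-* u (R l)) (*-congˡ (inK-R l∈K)))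
                                 (trans (φ-* l (R u)) (*-cong l∈K (φ-R u))))
    regroup : X + (φ u * R l + l * R (φ u)) ≈ Tr-rel u * R l + l * (R u + R (φ u))
    regroup = solve 6 (λ u v l A B C → (u :* A :+ l :* B) :+ (v :* A :+ l :* C) := (u :+ v) :* A :+ l :* (B :+ C))
                refl u (φ u) l _ _ _

  -- The c²-terms cancel, and the remaining monomials are moved into the shape l⁴(…) by Tr(y) = Tr(y²) = Tr(y⁴).
  Tr-k-symmetrised-R : ∀ {z l} → inK z → inK l → Tr-k (z * R l + l * R z) ≈ Tr-k (pow l 4 * E z)
  Tr-k-symmetrised-R {z} {l} z∈K l∈K = begin
    Tr-k (z * R l + l * R z)                    ≈⟨ Tr-k-cong expand ⟩
    Tr-k (((A + B) + C) + D)                    ≈⟨ Tr-k-+-cong (Tr-k-+-cong (Tr-k-+-cong refl (sym (Tr-k-square B∈K)))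
                                                     (sym (Tr-k-fourth C∈K))) (sym (Tr-k-fourth D∈K)) ⟩
    Tr-k (((A + pow B 2) + pow C 4) + pow D 4)  ≈⟨ Tr-k-cong collect ⟩
    Tr-k (pow l 4 * E z)                        ∎
    where
    A = a * z * pow l 4
    B = b * z * pow l 2
    C = a * l * pow z 4
    D = b * l * pow z 2
    B∈K = inK-* (inK-* b∈K z∈K) (inK-pow 2 l∈K)
    C∈K = inK-* (inK-* a∈K l∈K) (inK-pow 4 z∈K)
    D∈K = inK-* (inK-* b∈K l∈K) (inK-pow 2 z∈K)
    expand : z * R l + l * R z ≈ ((A + B) + C) + D
    expand = solve 5 (λ a b c z l →
               z :* (a :* l :^ 4 :+ b :* l :^ 2 :+ c :^ 2 :* l) :+ l :* (a :* z :^ 4 :+ b :* z :^ 2 :+ c :^ 2 :* z)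
               := ((a :* z :* l :^ 4 :+ b :* z :* l :^ 2) :+ a :* l :* z :^ 4) :+ b :* l :* z :^ 2)
             refl a b c z l
    collect : ((A + pow B 2) + pow C 4) + pow D 4 ≈ pow l 4 * E z
    collect = solve 4 (λ a b z l →
                ((a :* z :* l :^ 4 :+ (b :* z :* l :^ 2) :^ 2) :+ (a :* l :* z :^ 4) :^ 4) :+ (b :* l :* z :^ 2) :^ 4
                := l :^ 4 :* (a :^ 4 :* z :^ 16 :+ b :^ 4 :* z :^ 8 :+ b :^ 2 :* z :^ 2 :+ a :* z))
              refl a b z l

  pairing≈Tr-k[l⁴E] : ∀ u l → inK l → ⟨ u , l ⟩R ≈ Tr-k (pow l 4 * E (Tr-rel u))
  pairing≈Tr-k[l⁴E] u l l∈K = trans (pairing≈Tr-k u l l∈K) (Tr-k-symmetrised-R (inK-Tr-rel u) l∈K)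

  U⇔Tr-rel⁻¹W : ∀ u → inU u ⇔ inW (Tr-rel u)
  U⇔Tr-rel⁻¹W u = mk⇔
    (λ u∈U → inK-Tr-rel u , Tr-k-nondegenerate (inK-E (inK-Tr-rel u)) (λ l l∈K → begin
      Tr-k (l * E z)                        ≈⟨ Tr-k-cong (*-congʳ (sym (fourthRoot-spec l))) ⟩
      Tr-k (pow (fourthRoot l) 4 * E z)     ≈⟨ sym (pairing≈Tr-k[l⁴E] u (fourthRoot l) (inK-fourthRoot l∈K)) ⟩
      ⟨ u , fourthRoot l ⟩R                 ≈⟨ u∈U (fourthRoot l) (inK-fourthRoot l∈K) ⟩
      0#                                    ∎))
    (λ { (_ , E[z]≈0) l l∈K → begin
      ⟨ u , l ⟩R                 ≈⟨ pairing≈Tr-k[l⁴E] u l l∈K ⟩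
      Tr-k (pow l 4 * E z)       ≈⟨ Tr-k-cong (trans (*-congˡ E[z]≈0) (zeroʳ _)) ⟩
      Tr-k 0#                    ≈⟨ Tr-k-0 ⟩
      0#                         ∎ })
    where z = Tr-rel u

  norm : Carrier → Carrier
  norm u = u * φ u

  inK-norm : ∀ u → inK (norm u)
  inK-norm u = trans (φ-* u (φ u)) (trans (*-congˡ (φ-involutive u)) (*-comm (φ u) u))

  crossTerm : Carrier → Carrier
  crossTerm u = pow (norm u) 2 * (Tr-rel u * P (Tr-rel u))

  Q∘Tr-rel : ∀ u → Q (Tr-rel u) ≈ Q~ u + Tr-k (crossTerm u)
  Q∘Tr-rel u = begin
    Tr-k (f z)                           ≈⟨ Tr-k-cong expand ⟩
    Tr-k ((f u + f (φ u)) + (X + Y))     ≈⟨ Tr-k-+ _ _ ⟩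
    Tr-k (f u + f (φ u)) + Tr-k (X + Y)  ≈⟨ +-cong (trans (Tr-k-cong (+-congˡ (sym (φ-f u)))) (sym (Tr-k2≈Tr-k∘Tr-rel (f u))))
                                                   (Tr-k-+-cong (sym (Tr-k-square X∈K)) refl) ⟩
    Q~ u + Tr-k (pow X 2 + Y)            ≈⟨ +-congˡ (Tr-k-cong collect) ⟩
    Q~ u + Tr-k (crossTerm u)            ∎
    where
    z = Tr-rel u
    N = norm u
    X = a * N * pow z 3 + b * N * z
    Y = a * pow N 2 * z
    X∈K = inK-+ (inK-* (inK-* a∈K (inK-norm u)) (inK-pow 3 (inK-Tr-rel u))) (inK-* (inK-* b∈K (inK-norm u)) (inK-Tr-rel u))
    expand : f z ≈ (f u + f (φ u)) + (X + Y)
    expand = solve 5 (λ a b c u v →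
               a :* (u :+ v) :^ 5 :+ b :* (u :+ v) :^ 3 :+ c :* (u :+ v)
               := (a :* u :^ 5 :+ b :* u :^ 3 :+ c :* u) :+ (a :* v :^ 5 :+ b :* v :^ 3 :+ c :* v)
                  :+ ((a :* (u :* v) :* (u :+ v) :^ 3 :+ b :* (u :* v) :* (u :+ v)) :+ a :* (u :* v) :^ 2 :* (u :+ v)))
             refl a b c u (φ u)
    collect : pow X 2 + Y ≈ crossTerm u
    collect = solve 4 (λ a b N z →
                (a :* N :* z :^ 3 :+ b :* N :* z) :^ 2 :+ a :* N :^ 2 :* z
                := N :^ 2 :* (z :* (a :^ 2 :* z :^ 5 :+ b :^ 2 :* z :+ a)))
              refl a b N z

  -- With w = u / z one has w² + w = N / z², so the trace telescopes to (φ u + u) / z = 1.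
  Tr-k[norm/Tr-rel²] : ∀ u (z≉0 : ¬ Tr-rel u ≈ 0#) → Tr-k (norm u * pow ((Tr-rel u ⁻¹) z≉0) 2) ≈ 1#
  Tr-k[norm/Tr-rel²] u z≉0 = begin
    Tr-k (norm u * pow z⁻¹ 2)    ≈⟨ Tr-k-cong (sym w²+w≈N/z²) ⟩
    Tr-k (pow w 2 + w)           ≈⟨ Tr-k-x²+x w ⟩
    φ w + w                      ≈⟨ +-congʳ (trans (φ-* u z⁻¹) (*-congˡ (inK-⁻¹ z≉0 (inK-Tr-rel u)))) ⟩
    φ u * z⁻¹ + u * z⁻¹          ≈⟨ solve 3 (λ u v zi → v :* zi :+ u :* zi := (u :+ v) :* zi) refl u (φ u) z⁻¹ ⟩
    Tr-rel u * z⁻¹               ≈⟨ *-inverseʳ (Tr-rel u) z≉0 ⟩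
    1#                           ∎
    where
    z⁻¹ = (Tr-rel u ⁻¹) z≉0
    w = u * z⁻¹
    w²+w≈N/z² : pow w 2 + w ≈ norm u * pow z⁻¹ 2
    w²+w≈N/z² = begin
      pow w 2 + w                                     ≈⟨ solve 3 (λ u v zi →
                                                           (u :* zi) :^ 2 :+ u :* zi
                                                           := (u :* v) :* zi :^ 2 :+ u :* zi :* (con true :+ zi :* (u :+ v)))
                                                         refl u (φ u) z⁻¹ ⟩
      norm u * pow z⁻¹ 2 + w * (1# + z⁻¹ * Tr-rel u)  ≈⟨ +-congˡ (*-congˡ (trans (+-congˡ (*-inverseˡ _ z≉0)) 1+1≈0)) ⟩
      norm u * pow z⁻¹ 2 + w * 0#                     ≈⟨ trans (+-congˡ (zeroʳ w)) (+-identityʳ _) ⟩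
      norm u * pow z⁻¹ 2                              ∎

  Tr-k[crossTerm] : ∀ u → E (Tr-rel u) ≈ 0# → Tr-k (crossTerm u) ≈ pow (Tr-rel u) 5 * P (Tr-rel u)
  Tr-k[crossTerm] u E[z]≈0 with Tr-rel u ≟ 0#
  ... | yes z≈0 = trans (Tr-k-cong (trans (*-congˡ (trans (*-congʳ z≈0) (zeroˡ _))) (zeroʳ _)))
                        (trans Tr-k-0 (sym (trans (*-congʳ (pow-cong 5 z≈0)) (trans (*-congʳ (zeroˡ _)) (zeroˡ _)))))
  ... | no z≉0 = begin
    Tr-k (crossTerm u)       ≈⟨ Tr-k-cong crossTerm≈t²M ⟩
    Tr-k (pow t 2 * M)       ≈⟨ Tr-k[t²M] (x²+x≈0⇒x≈0⊎x≈1 M²+M≈0) ⟩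
    M                        ∎
    where
    z = Tr-rel u
    z⁻¹ = (z ⁻¹) z≉0
    t = norm u * pow z⁻¹ 2
    M = pow z 5 * P z

    M²+M≈0 : pow M 2 + M ≈ 0#
    M²+M≈0 = trans (solve 3 (λ a b z →
                      (z :^ 5 :* (a :^ 2 :* z :^ 5 :+ b :^ 2 :* z :+ a)) :^ 2 :+ z :^ 5 :* (a :^ 2 :* z :^ 5 :+ b :^ 2 :* z :+ a)
                      := z :^ 4 :* (a :^ 4 :* z :^ 16 :+ b :^ 4 :* z :^ 8 :+ b :^ 2 :* z :^ 2 :+ a :* z))
                    refl a b z)
                   (trans (*-congˡ E[z]≈0) (zeroʳ _))

    crossTerm≈t²M : crossTerm u ≈ pow t 2 * M
    crossTerm≈t²M = sym (begin
      pow t 2 * M                     ≈⟨ solve 5 (λ a b N zi z →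
                                            (N :* zi :^ 2) :^ 2 :* (z :^ 5 :* (a :^ 2 :* z :^ 5 :+ b :^ 2 :* z :+ a))
                                            := N :^ 2 :* (z :* (a :^ 2 :* z :^ 5 :+ b :^ 2 :* z :+ a)) :* (z :* zi) :^ 4)
                                          refl a b (norm u) z⁻¹ z ⟩
      crossTerm u * pow (z * z⁻¹) 4   ≈⟨ *-congˡ (trans (pow-cong 4 (*-inverseʳ z z≉0)) (solve 0 (con true :^ 4 := con true) refl)) ⟩
      crossTerm u * 1#                ≈⟨ *-identityʳ _ ⟩
      crossTerm u                     ∎)

    Tr-k[t²M] : M ≈ 0# ⊎ M ≈ 1# → Tr-k (pow t 2 * M) ≈ M
    Tr-k[t²M] (inj₁ M≈0) = trans (Tr-k-cong (trans (*-congˡ M≈0) (zeroʳ _))) (trans Tr-k-0 (sym M≈0))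
    Tr-k[t²M] (inj₂ M≈1) = begin
      Tr-k (pow t 2 * M)   ≈⟨ Tr-k-cong (trans (*-congˡ M≈1) (*-identityʳ _)) ⟩
      Tr-k (pow t 2)       ≈⟨ Tr-k-square (inK-* (inK-norm u) (inK-pow 2 (inK-⁻¹ z≉0 (inK-Tr-rel u)))) ⟩
      Tr-k t               ≈⟨ Tr-k[norm/Tr-rel²] u z≉0 ⟩
      1#                   ≈⟨ sym M≈1 ⟩
      M                    ∎

  Q~≈Q⇔P≈0⊎z≈0 : ∀ u → inU u → (Q~ u ≈ Q (Tr-rel u)) ⇔ (P (Tr-rel u) ≈ 0# ⊎ Tr-rel u ≈ 0#)
  Q~≈Q⇔P≈0⊎z≈0 u u∈U = z⁵P≈0⇔ ⇔-∘ (cross≈0⇔ ⇔-∘ Q~≈Q⇔cross≈0)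
    where
    open AbelianGroupProperties +-abelianGroup using (identityʳ-unique)
    z = Tr-rel u
    Q~≈Q⇔cross≈0 : (Q~ u ≈ Q z) ⇔ (Tr-k (crossTerm u) ≈ 0#)
    Q~≈Q⇔cross≈0 = mk⇔
      (λ Q~≈Q → identityʳ-unique (Q~ u) _ (trans (sym (Q∘Tr-rel u)) (sym Q~≈Q)))
      (λ cross≈0 → sym (trans (Q∘Tr-rel u) (trans (+-congˡ cross≈0) (+-identityʳ (Q~ u)))))
    cross≈0⇔ : (Tr-k (crossTerm u) ≈ 0#) ⇔ (pow z 5 * P z ≈ 0#)
    cross≈0⇔ = mk⇔ (trans (sym cross≈z⁵P)) (trans cross≈z⁵P)
      where cross≈z⁵P = Tr-k[crossTerm] u (proj₂ (Equivalence.to (U⇔Tr-rel⁻¹W u) u∈U))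
    z⁵P≈0⇔ : (pow z 5 * P z ≈ 0#) ⇔ (P z ≈ 0# ⊎ z ≈ 0#)
    z⁵P≈0⇔ = mk⇔
      (λ z⁵P≈0 → swap (map₁ (^≈0⇒≈0 5) (x*y≈0⇒x≈0⊎y≈0 z⁵P≈0)))
      (λ { (inj₁ P≈0) → trans (*-congˡ P≈0) (zeroʳ _)
         ; (inj₂ z≈0) → trans (*-congʳ (pow-cong 5 z≈0)) (trans (*-congʳ (zeroˡ _)) (zeroˡ _)) })

proposition3p4 : {ℓ₁ ℓ₂ : Level} (m : ℕ) → 1 ≤ m →
    (K2 : FieldOfOrder (2 ^ℕ (2 *ℕ m)) ℓ₁ ℓ₂) →
    let open FieldOfOrder K2 in
    let open Setting m K2 in
    (a b c : Carrier) → inK a → ¬ (a ≈ 0#) → inK b → inK c →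
    let open Params a b c in
    ((u : Carrier) → inU u ⇔ inW (Tr-rel u))
    × ((u : Carrier) → inU u →
        (Q~ u ≈ Q (Tr-rel u)) ⇔ (P (Tr-rel u) ≈ 0# ⊎ Tr-rel u ≈ 0#))
proposition3p4 m 1≤m K2 a b c a∈K _ b∈K c∈K = U⇔Tr-rel⁻¹W , Q~≈Q⇔P≈0⊎z≈0
  where open QuadraticForm m 1≤m K2 a b c a∈K b∈K c∈K
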